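{- For every even integer $k \geq 4$ and every odd integer $t \geq 3$, the graph $C_k \times K_t$ has a $C_{kt}$-factorization.
   Context: $C_m$ denotes the cycle on $m$ vertices and $K_n$ the complete graph on $n$ vertices. For graphs $G,H$, the tensor product $G \times H$ has vertex set $V(G)\times V(H)$, with $(g_1,h_1)$ adjacent to $(g_2,h_2)$ iff $g_1g_2 \in E(G)$ and $h_1h_2 \in E(H)$. A $C_m$-factor of a graph is a spanning subgraph all of whose components are cycles of length $m$; a $C_m$-factorization is a partition of the edge set into $C_m$-factors. -}

module Defs where

open import Data.Nat using (ℕ; suc; _≡ᵇ_)
open import Data.Bool using (Bool; true; false; _∧_; _∨_; not; T)
open import Data.Fin using (Fin; toℕ)
open import Data.Product using (Σ; ∃; _×_; _,_)
open import Relation.Binary.PropositionalEquality using (_≡_)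
open import Function.Bundles using (_⇔_)

Graph : Set → Set
Graph V = V → V → Bool

-- Cycle C_m on vertex set Fin m (vertices 0,1,…,m-1, i ~ i+1 mod m).
-- Two vertices are adjacent iff one is the successor of the other, or they are
-- 0 and m-1.  (Used only for m ≥ 3.)
cycleG : (m : ℕ) → Graph (Fin m)
cycleG m i j =
  (suc (toℕ i) ≡ᵇ toℕ j) ∨ (suc (toℕ j) ≡ᵇ toℕ i)
  ∨ ((toℕ i ≡ᵇ 0) ∧ (suc (toℕ j) ≡ᵇ m))
  ∨ ((toℕ j ≡ᵇ 0) ∧ (suc (toℕ i) ≡ᵇ m))

completeG : (n : ℕ) → Graph (Fin n)
completeG n i j = not (toℕ i ≡ᵇ toℕ j)

tensorG : {A B : Set} → Graph A → Graph B → Graph (A × B)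
tensorG G H (g₁ , h₁) (g₂ , h₂) = G g₁ g₂ ∧ H h₁ h₂

-- H (a relation on V) is a C_m-factor of G: a spanning subgraph of G whose
-- components are cycles of length m, i.e. H is the vertex-disjoint union of
-- r cycles of length m (cycle a has vertices cyc a 0, …, cyc a (m-1) in cyclic
-- order) covering every vertex, and the edges of H are exactly the cycle edges,
-- each of which is an edge of G.
record IsCycleFactor {V : Set} (m : ℕ) (G : Graph V) (H : V → V → Set) : Set where
  field
    r         : ℕ
    cyc       : Fin r → Fin m → V
    injective : ∀ a i b j → cyc a i ≡ cyc b j → (a ≡ b) × (i ≡ j)
    covering  : ∀ v → ∃ λ a → ∃ λ i → cyc a i ≡ v
    edges     : ∀ u v → H u v ⇔ (∃ λ a → ∃ λ i → ∃ λ j →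
                  T (cycleG m i j) × (cyc a i ≡ u) × (cyc a j ≡ v))
    subgraph  : ∀ u v → H u v → T (G u v)

-- G has a C_m-factorization: a partition of the edge set of G into C_m-factors,
-- given as a colouring of the edges by s colours (symmetric on edges) such that
-- every colour class is a C_m-factor of G.
record CycleFactorization {V : Set} (m : ℕ) (G : Graph V) : Set where
  field
    s         : ℕ
    colour    : V → V → Fin s
    symmetric : ∀ u v → T (G u v) → colour u v ≡ colour v u
    factor    : ∀ c → IsCycleFactor m G (λ u v → T (G u v) × (colour u v ≡ c))

{-# OPTIONS --safe #-}

-- Write the vertices of C_k × K_t as (i, x) with layer i ∈ ℤ_k and value x ∈ ℤ_t; every edge
-- joins (i, x) to (i + 1, x + d) for some d ≠ 0. Give that edge colour σᵢ(d), where each σᵢ is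
-- an involution of the nonzero residues: the identity on even layers, d ↦ -d on odd layers, and
-- on the last layer d ↦ 1 - d for d ≠ 1, fixing 1. Then the colour class c is the graph of the
-- permutation (i, x) ↦ (i + 1, x + σᵢ(c)). As k is even, one round through all layers adds
-- c + σ_{k-1}(c), which is 2 or 1 modulo t, hence a unit because t is odd. So the walk from (0, 0)
-- visits all kt vertices before it closes up: every colour class is a Hamiltonian cycle.

module Submission where

open import Defs
open import Data.Nat using (ℕ; zero; suc; _+_; _*_; _∸_; _<_; _≤_; _%_; NonZero; z≤n; s≤s; z<s; _≡ᵇ_; >-nonZero⁻¹)
open import Data.Nat.Properties
open import Data.Nat.DivMod
open import Data.Nat.Tactic.RingSolver using (solve-∀)
open import Data.Nat.Divisibility using (_∣_; divides)
open import Data.Fin using (Fin; toℕ; fromℕ<; fromℕ; zero; suc; opposite; punchOut)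
open import Data.Fin.Properties
  using (toℕ-injective; toℕ<n; toℕ-fromℕ<; toℕ-fromℕ; fromℕ-def; any?; pigeonhole; punchOut-injective;
         opposite-prop; opposite-involutive; *↔×)
  renaming (_≟_ to _≟ᶠ_)
open import Data.Nat.GeneralisedArithmetic using (fold; fold-+)
open import Data.Bool using (Bool; true; false; not; T; _∨_; _∧_)
open import Data.Bool.Properties using (∨-zeroʳ; ∨-identityʳ; T-∨; T-∧; T-not-≡)
open import Data.Product using (_×_; _,_; ∃; proj₁; proj₂)
open import Data.Product.Properties using (×-≡,≡→≡)
open import Data.Product.Function.NonDependent.Propositional using (_×-⇔_)
open import Data.Sum using (_⊎_; inj₁; inj₂; swap)
open import Data.Sum.Function.Propositional using (_⊎-⇔_)
open import Data.Unit using (tt)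
open import Function.Base using (_∘_; id)
open import Function.Bundles using (_⇔_; mk⇔; Equivalence; _↔_; Inverse)
open import Function.Properties.Equivalence using () renaming (trans to ⇔-trans)
open import Relation.Nullary using (¬_; contradiction; yes; no)
open import Relation.Binary.PropositionalEquality

[m%n+o]%n≡[m+o]%n : ∀ m o n .{{_ : NonZero n}} → (m % n + o) % n ≡ (m + o) % n
[m%n+o]%n≡[m+o]%n m o n = begin
  (m % n + o) % n          ≡⟨ %-distribˡ-+ (m % n) o n ⟩
  (m % n % n + o % n) % n  ≡⟨ cong (λ a → (a + o % n) % n) (m%n%n≡m%n m n) ⟩
  (m % n + o % n) % n      ≡⟨ %-distribˡ-+ m o n ⟨
  (m + o) % n              ∎
  where open ≡-Reasoning

[m+o%n]%n≡[m+o]%n : ∀ m o n .{{_ : NonZero n}} → (m + o % n) % n ≡ (m + o) % n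
[m+o%n]%n≡[m+o]%n m o n = begin
  (m + o % n) % n  ≡⟨ cong (_% n) (+-comm m (o % n)) ⟩
  (o % n + m) % n  ≡⟨ [m%n+o]%n≡[m+o]%n o m n ⟩
  (o + m) % n      ≡⟨ cong (_% n) (+-comm o m) ⟩
  (m + o) % n      ∎
  where open ≡-Reasoning

%-+-congʳ : ∀ o {a b} n .{{_ : NonZero n}} → a % n ≡ b % n → (a + o) % n ≡ (b + o) % n
%-+-congʳ o {a} {b} n eq = begin
  (a + o) % n      ≡⟨ [m%n+o]%n≡[m+o]%n a o n ⟨
  (a % n + o) % n  ≡⟨ cong (λ x → (x + o) % n) eq ⟩
  (b % n + o) % n  ≡⟨ [m%n+o]%n≡[m+o]%n b o n ⟩
  (b + o) % n      ∎
  where open ≡-Reasoning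

%-*-congʳ : ∀ o {a b} n .{{_ : NonZero n}} → a % n ≡ b % n → (a * o) % n ≡ (b * o) % n
%-*-congʳ o {a} {b} n eq = begin
  (a * o) % n                ≡⟨ %-distribˡ-* a o n ⟩
  (a % n * (o % n)) % n      ≡⟨ cong (λ x → (x * (o % n)) % n) eq ⟩
  (b % n * (o % n)) % n      ≡⟨ %-distribˡ-* b o n ⟨
  (b * o) % n                ∎
  where open ≡-Reasoning

%-+-cancelʳ : ∀ o {a b} n .{{_ : NonZero n}} → (a + o) % n ≡ (b + o) % n → a % n ≡ b % n
%-+-cancelʳ o {a} {b} n@(suc n-1) eq = begin
  a % n                       ≡⟨ add-multiple a ⟨
  (a + o + o * n-1) % n       ≡⟨ %-+-congʳ (o * n-1) {a + o} {b + o} n eq ⟩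
  (b + o + o * n-1) % n       ≡⟨ add-multiple b ⟩
  b % n                       ∎
  where
  open ≡-Reasoning
  add-multiple : ∀ x → (x + o + o * n-1) % n ≡ x % n
  add-multiple x = begin
    (x + o + o * n-1) % n    ≡⟨ cong (_% n) (+-assoc x o (o * n-1)) ⟩
    (x + (o + o * n-1)) % n  ≡⟨ cong (λ y → (x + y) % n) (*-suc o n-1) ⟨
    (x + o * n) % n          ≡⟨ [m+kn]%n≡m%n x o n ⟩
    x % n                    ∎

%-*-cancelʳ : ∀ {u u⁻¹} n .{{_ : NonZero n}} → (u * u⁻¹) % n ≡ 1 % n →
              ∀ {a b} → (a * u) % n ≡ (b * u) % n → a % n ≡ b % n
%-*-cancelʳ {u} {u⁻¹} n unit {a} {b} eq = begin
  a % n                ≡⟨ times-unit a ⟨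
  (a * u * u⁻¹) % n    ≡⟨ %-*-congʳ u⁻¹ {a * u} {b * u} n eq ⟩
  (b * u * u⁻¹) % n    ≡⟨ times-unit b ⟩
  b % n                ∎
  where
  open ≡-Reasoning
  times-unit : ∀ x → (x * u * u⁻¹) % n ≡ x % n
  times-unit x = begin
    (x * u * u⁻¹) % n        ≡⟨ cong (_% n) (*-assoc x u u⁻¹) ⟩
    (x * (u * u⁻¹)) % n      ≡⟨ cong (_% n) (*-comm x (u * u⁻¹)) ⟩
    (u * u⁻¹ * x) % n        ≡⟨ %-*-congʳ x {u * u⁻¹} {1} n unit ⟩
    (1 * x) % n              ≡⟨ cong (_% n) (*-identityˡ x) ⟩
    x % n                    ∎

module _ {n : ℕ} .{{_ : NonZero n}} where

  rotate : ℕ → Fin n → Fin n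
  rotate d x = (toℕ x + d) mod n

  toℕ-rotate : ∀ d (x : Fin n) → toℕ (rotate d x) ≡ (toℕ x + d) % n
  toℕ-rotate d x = toℕ-fromℕ< _

  rotate-+ : ∀ a b (x : Fin n) → rotate b (rotate a x) ≡ rotate (a + b) x
  rotate-+ a b x = toℕ-injective (begin
    toℕ (rotate b (rotate a x))  ≡⟨ toℕ-rotate b (rotate a x) ⟩
    (toℕ (rotate a x) + b) % n   ≡⟨ cong (λ y → (y + b) % n) (toℕ-rotate a x) ⟩
    ((toℕ x + a) % n + b) % n    ≡⟨ [m%n+o]%n≡[m+o]%n (toℕ x + a) b n ⟩
    (toℕ x + a + b) % n          ≡⟨ cong (_% n) (+-assoc (toℕ x) a b) ⟩
    (toℕ x + (a + b)) % n        ≡⟨ toℕ-rotate (a + b) x ⟨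
    toℕ (rotate (a + b) x)       ∎)
    where open ≡-Reasoning

  rotate-multiple : ∀ q (x : Fin n) → rotate (q * n) x ≡ x
  rotate-multiple q x = toℕ-injective (begin
    toℕ (rotate (q * n) x)  ≡⟨ toℕ-rotate (q * n) x ⟩
    (toℕ x + q * n) % n     ≡⟨ [m+kn]%n≡m%n (toℕ x) q n ⟩
    toℕ x % n               ≡⟨ m<n⇒m%n≡m (toℕ<n x) ⟩
    toℕ x                   ∎)
    where open ≡-Reasoning

  rotate-0 : ∀ (x : Fin n) → rotate 0 x ≡ x
  rotate-0 = rotate-multiple 0

  diff : Fin n → Fin n → Fin n
  diff x y = (toℕ y + (n ∸ toℕ x)) mod n

  [a+x+[n∸x]]%n≡a%n : ∀ a (x : Fin n) → (a + toℕ x + (n ∸ toℕ x)) % n ≡ a % n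
  [a+x+[n∸x]]%n≡a%n a x = begin
    (a + toℕ x + (n ∸ toℕ x)) % n    ≡⟨ cong (_% n) (+-assoc a (toℕ x) (n ∸ toℕ x)) ⟩
    (a + (toℕ x + (n ∸ toℕ x))) % n  ≡⟨ cong (λ y → (a + y) % n) (m+[n∸m]≡n (<⇒≤ (toℕ<n x))) ⟩
    (a + n) % n                       ≡⟨ [m+n]%n≡m%n a n ⟩
    a % n                             ∎
    where open ≡-Reasoning

  rotate-diff : ∀ (x y : Fin n) → rotate (toℕ (diff x y)) x ≡ y
  rotate-diff x y = toℕ-injective (begin
    toℕ (rotate (toℕ (diff x y)) x)          ≡⟨ toℕ-rotate _ x ⟩
    (toℕ x + toℕ (diff x y)) % n             ≡⟨ cong (λ d → (toℕ x + d) % n) (toℕ-fromℕ< _) ⟩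
    (toℕ x + (toℕ y + (n ∸ toℕ x)) % n) % n  ≡⟨ [m+o%n]%n≡[m+o]%n (toℕ x) _ n ⟩
    (toℕ x + (toℕ y + (n ∸ toℕ x))) % n      ≡⟨ cong (_% n) (+-assoc (toℕ x) (toℕ y) _) ⟨
    (toℕ x + toℕ y + (n ∸ toℕ x)) % n        ≡⟨ cong (λ z → (z + (n ∸ toℕ x)) % n) (+-comm (toℕ x) (toℕ y)) ⟩
    (toℕ y + toℕ x + (n ∸ toℕ x)) % n        ≡⟨ [a+x+[n∸x]]%n≡a%n (toℕ y) x ⟩
    toℕ y % n                                ≡⟨ m<n⇒m%n≡m (toℕ<n y) ⟩
    toℕ y                                    ∎)
    where open ≡-Reasoning

  diff-rotate : ∀ {d} (x : Fin n) → d < n → toℕ (diff x (rotate d x)) ≡ d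
  diff-rotate {d} x d<n = begin
    toℕ (diff x (rotate d x))                     ≡⟨ toℕ-fromℕ< _ ⟩
    (toℕ (rotate d x) + (n ∸ toℕ x)) % n          ≡⟨ cong (λ z → (z + (n ∸ toℕ x)) % n) (toℕ-rotate d x) ⟩
    ((toℕ x + d) % n + (n ∸ toℕ x)) % n           ≡⟨ [m%n+o]%n≡[m+o]%n (toℕ x + d) _ n ⟩
    (toℕ x + d + (n ∸ toℕ x)) % n                 ≡⟨ cong (λ z → (z + (n ∸ toℕ x)) % n) (+-comm (toℕ x) d) ⟩
    (d + toℕ x + (n ∸ toℕ x)) % n                 ≡⟨ [a+x+[n∸x]]%n≡a%n d x ⟩
    d % n                                         ≡⟨ m<n⇒m%n≡m d<n ⟩
    d                                             ∎
    where open ≡-Reasoning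

  rotate-≢ : ∀ {d} (x : Fin n) → 0 < d → d < n → rotate d x ≢ x
  rotate-≢ {d} x 0<d d<n rotate-d-x≡x = <⇒≢ 0<d (sym (begin
    d                           ≡⟨ diff-rotate x d<n ⟨
    toℕ (diff x (rotate d x))  ≡⟨ cong (toℕ ∘ diff x) (trans rotate-d-x≡x (sym (rotate-0 x))) ⟩
    toℕ (diff x (rotate 0 x))  ≡⟨ diff-rotate x (>-nonZero⁻¹ n) ⟩
    0                           ∎))
    where open ≡-Reasoning

  rotate-1-fromℕ< : ∀ {i} .(i<n : i < n) (1+i<n : suc i < n) → rotate 1 (fromℕ< i<n) ≡ fromℕ< 1+i<n
  rotate-1-fromℕ< {i} i<n 1+i<n = toℕ-injective (begin
    toℕ (rotate 1 (fromℕ< i<n))  ≡⟨ toℕ-rotate 1 (fromℕ< i<n) ⟩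
    (toℕ (fromℕ< i<n) + 1) % n   ≡⟨ cong (λ j → (j + 1) % n) (toℕ-fromℕ< i<n) ⟩
    (i + 1) % n                  ≡⟨ cong (_% n) (+-comm i 1) ⟩
    suc i % n                    ≡⟨ m<n⇒m%n≡m 1+i<n ⟩
    suc i                        ≡⟨ toℕ-fromℕ< 1+i<n ⟨
    toℕ (fromℕ< 1+i<n)           ∎)
    where open ≡-Reasoning

  rotate-1-asymmetric : 2 < n → ∀ {i j : Fin n} → j ≡ rotate 1 i → i ≢ rotate 1 j
  rotate-1-asymmetric 2<n {i} refl i≡ = rotate-≢ i z<s 2<n (sym (trans i≡ (rotate-+ 1 1 i)))

rotate-1-fromℕ : ∀ n → rotate 1 (fromℕ n) ≡ zero
rotate-1-fromℕ n = toℕ-injective (begin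
  toℕ (rotate 1 (fromℕ n))  ≡⟨ toℕ-rotate 1 (fromℕ n) ⟩
  (toℕ (fromℕ n) + 1) % suc n ≡⟨ cong (λ j → (j + 1) % suc n) (toℕ-fromℕ n) ⟩
  (n + 1) % suc n             ≡⟨ cong (_% suc n) (+-comm n 1) ⟩
  suc n % suc n               ≡⟨ n%n≡0 (suc n) ⟩
  0                           ∎)
  where open ≡-Reasoning

module _ {m : ℕ} where

  -- A nonzero residue suc c : Fin (2 + m) is represented by c : Fin (1 + m), and gap x y
  -- represents y - x (junk value zero when x = y).
  gap : Fin (2 + m) → Fin (2 + m) → Fin (1 + m)
  gap x y with diff x y
  ... | zero  = zero
  ... | suc g = g

  gap-spec : ∀ (x y : Fin (2 + m)) c → (x ≢ y × gap x y ≡ c) ⇔ y ≡ rotate (suc (toℕ c)) x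
  gap-spec x y c = mk⇔ to from
    where
    to : x ≢ y × gap x y ≡ c → y ≡ rotate (suc (toℕ c)) x
    to (x≢y , refl) with diff x y in eq
    ... | zero  = contradiction (trans (sym (rotate-0 x)) (subst (λ d → rotate (toℕ d) x ≡ y) eq (rotate-diff x y))) x≢y
    ... | suc g = trans (sym (rotate-diff x y)) (cong (λ d → rotate (toℕ d) x) eq)
    from : y ≡ rotate (suc (toℕ c)) x → x ≢ y × gap x y ≡ c
    from y≡ = (λ x≡y → rotate-≢ x z<s (s≤s (toℕ<n c)) (sym (trans x≡y y≡))) , gap≡c
      where
      toℕ-diff : toℕ (diff x y) ≡ suc (toℕ c)
      toℕ-diff = subst (λ z → toℕ (diff x z) ≡ suc (toℕ c)) (sym y≡) (diff-rotate x (s≤s (toℕ<n c)))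
      gap≡c : gap x y ≡ c
      gap≡c with diff x y in eq
      ... | zero  = contradiction (trans (sym toℕ-diff) (cong toℕ eq)) 1+n≢0
      ... | suc g = toℕ-injective (suc-injective (trans (cong toℕ (sym eq)) toℕ-diff))

T-≡ᵇ : ∀ a b → T (a ≡ᵇ b) ⇔ a ≡ b
T-≡ᵇ a b = mk⇔ (≡ᵇ⇒≡ a b) (≡⇒≡ᵇ a b)

T-not-≡ᵇ : ∀ a b → T (not (a ≡ᵇ b)) ⇔ a ≢ b
T-not-≡ᵇ a b = mk⇔ to from
  where
  to : T (not (a ≡ᵇ b)) → a ≢ b
  to h a≡b = subst T (Equivalence.to T-not-≡ h) (≡⇒≡ᵇ a b a≡b)
  from : a ≢ b → T (not (a ≡ᵇ b))
  from a≢b with a ≡ᵇ b in eq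
  ... | true  = contradiction (≡ᵇ⇒≡ a b (subst T (sym eq) tt)) a≢b
  ... | false = tt

completeG-adjacent : ∀ {n} (x y : Fin n) → T (completeG n x y) ⇔ x ≢ y
completeG-adjacent x y = ⇔-trans (T-not-≡ᵇ (toℕ x) (toℕ y))
  (mk⇔ (λ x≢y → x≢y ∘ cong toℕ) (λ x≢y → x≢y ∘ toℕ-injective))

∨-rearrange : ∀ a b c d → a ∨ (b ∨ (c ∨ d)) ≡ (a ∨ d) ∨ (b ∨ c)
∨-rearrange true  b     c     d = refl
∨-rearrange false true  c     d = sym (∨-zeroʳ d)
∨-rearrange false false true  d = sym (∨-zeroʳ d)
∨-rearrange false false false d = sym (∨-identityʳ d)

module _ {m : ℕ} .{{_ : NonZero m}} where

  successorᵇ : ℕ → ℕ → Bool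
  successorᵇ a b = (suc a ≡ᵇ b) ∨ ((b ≡ᵇ 0) ∧ (suc a ≡ᵇ m))

  T-successorᵇ : ∀ (i j : Fin m) → T (successorᵇ (toℕ i) (toℕ j)) ⇔ j ≡ rotate 1 i
  T-successorᵇ i j = ⇔-trans T-∨ (⇔-trans (T-≡ᵇ _ _ ⊎-⇔ ⇔-trans T-∧ (T-≡ᵇ _ _ ×-⇔ T-≡ᵇ _ _))
                       (mk⇔ to from))
    where
    a = toℕ i
    b = toℕ j
    toℕ-rotate-1 : toℕ (rotate 1 i) ≡ suc a % m
    toℕ-rotate-1 = trans (toℕ-rotate 1 i) (cong (_% m) (+-comm a 1))
    to : suc a ≡ b ⊎ (b ≡ 0 × suc a ≡ m) → j ≡ rotate 1 i
    to (inj₁ 1+a≡b)        = toℕ-injective (begin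
      b          ≡⟨ sym 1+a≡b ⟩
      suc a      ≡⟨ m<n⇒m%n≡m (subst (_< m) (sym 1+a≡b) (toℕ<n j)) ⟨
      suc a % m  ≡⟨ toℕ-rotate-1 ⟨
      toℕ (rotate 1 i) ∎)
      where open ≡-Reasoning
    to (inj₂ (b≡0 , 1+a≡m)) = toℕ-injective (begin
      b          ≡⟨ b≡0 ⟩
      0          ≡⟨ n%n≡0 m ⟨
      m % m      ≡⟨ %-congˡ 1+a≡m ⟨
      suc a % m  ≡⟨ toℕ-rotate-1 ⟨
      toℕ (rotate 1 i) ∎)
      where open ≡-Reasoning
    from : j ≡ rotate 1 i → suc a ≡ b ⊎ (b ≡ 0 × suc a ≡ m)
    from j≡ with m≤n⇒m<n∨m≡n (toℕ<n i)
    ... | inj₁ 1+a<m = inj₁ (sym (trans (cong toℕ j≡) (trans toℕ-rotate-1 (m<n⇒m%n≡m 1+a<m))))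
    ... | inj₂ 1+a≡m = inj₂ (trans (cong toℕ j≡) (trans toℕ-rotate-1 (trans (%-congˡ 1+a≡m) (n%n≡0 m))) , 1+a≡m)

  cycleG-adjacent : ∀ (i j : Fin m) → T (cycleG m i j) ⇔ (j ≡ rotate 1 i ⊎ i ≡ rotate 1 j)
  cycleG-adjacent i j =
    ⇔-trans (subst (λ b → T (cycleG m i j) ⇔ T b) rearranged (mk⇔ id id))
            (⇔-trans T-∨ (T-successorᵇ i j ⊎-⇔ T-successorᵇ j i))
    where
    a = toℕ i
    b = toℕ j
    rearranged : cycleG m i j ≡ successorᵇ a b ∨ successorᵇ b a
    rearranged = ∨-rearrange (suc a ≡ᵇ b) (suc b ≡ᵇ a) ((a ≡ᵇ 0) ∧ (suc b ≡ᵇ m)) ((b ≡ᵇ 0) ∧ (suc a ≡ᵇ m))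

Fin-injective⇒surjective : ∀ {n} (h : Fin n → Fin n) → (∀ {a b} → h a ≡ h b → a ≡ b) →
                           ∀ y → ∃ λ a → h a ≡ y
Fin-injective⇒surjective {suc n} h h-injective y with any? (λ a → h a ≟ᶠ y)
... | yes hit = hit
... | no miss =
  let a , b , a<b , collision = pigeonhole (n<1+n n) (λ a → punchOut {i = y} (miss ∘ (a ,_) ∘ sym)) in
  contradiction (h-injective (punchOut-injective (miss ∘ (a ,_) ∘ sym) (miss ∘ (b ,_) ∘ sym) collision))
                (<⇒≢ a<b ∘ cong toℕ)

injective⇒surjective : ∀ {n} {V : Set} → Fin n ↔ V → (g : Fin n → V) →
                       (∀ {a b} → g a ≡ g b → a ≡ b) → ∀ v → ∃ λ a → g a ≡ v
injective⇒surjective {n} {V} e g g-injective v =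
  let a , hit = Fin-injective⇒surjective (from ∘ g) (g-injective ∘ from-injective) (from v) in
  a , from-injective hit
  where
  open Inverse e
  from-injective : ∀ {u w : V} → from u ≡ from w → u ≡ w
  from-injective {u} {w} eq = trans (sym (strictlyInverseˡ u)) (trans (cong to eq) (strictlyInverseˡ w))

fold-periodic : ∀ {A : Set} (v : A) (f : A → A) N .{{_ : NonZero N}} →
                fold v f N ≡ v → ∀ n → fold v f (n % N) ≡ fold v f n
fold-periodic v f N period n = begin
  fold v f (n % N)                          ≡⟨ cong (λ w → fold w f (n % N)) (fold-multiple (n / N)) ⟨
  fold (fold v f (n / N * N)) f (n % N)     ≡⟨ fold-+ v f (n % N) ⟨
  fold v f (n % N + n / N * N)              ≡⟨ cong (fold v f) (m≡m%n+[m/n]*n n N) ⟨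
  fold v f n                                ∎
  where
  open ≡-Reasoning
  fold-multiple : ∀ q → fold v f (q * N) ≡ v
  fold-multiple zero    = refl
  fold-multiple (suc q) = trans (fold-+ v f N) (trans (cong (λ w → fold w f N) (fold-multiple q)) period)

module _ {V : Set} {N : ℕ} .{{_ : NonZero N}} (f : V → V) (v₀ : V) where

  orbit : Fin N → V
  orbit n = fold v₀ f (toℕ n)

  orbit-rotate-1 : fold v₀ f N ≡ v₀ → ∀ n → orbit (rotate 1 n) ≡ f (orbit n)
  orbit-rotate-1 period n = begin
    fold v₀ f (toℕ (rotate 1 n))    ≡⟨ cong (fold v₀ f) (toℕ-rotate 1 n) ⟩
    fold v₀ f ((toℕ n + 1) % N)     ≡⟨ fold-periodic v₀ f N period (toℕ n + 1) ⟩
    fold v₀ f (toℕ n + 1)           ≡⟨ cong (fold v₀ f) (+-comm (toℕ n) 1) ⟩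
    f (fold v₀ f (toℕ n))           ∎
    where open ≡-Reasoning

  orbit⇒IsCycleFactor : (G : Graph V) (H : V → V → Set) →
    fold v₀ f N ≡ v₀ →
    (∀ {a b} → orbit a ≡ orbit b → a ≡ b) →
    (∀ v → ∃ λ a → orbit a ≡ v) →
    (∀ u w → H u w ⇔ (w ≡ f u ⊎ u ≡ f w)) →
    (∀ u w → H u w → T (G u w)) →
    IsCycleFactor N G H
  orbit⇒IsCycleFactor G H period orbit-injective orbit-surjective H⇔ H⊆G = record
    { r         = 1
    ; cyc       = λ _ → orbit
    ; injective = λ { zero i zero j eq → refl , orbit-injective eq }
    ; covering  = λ v → let a , hit = orbit-surjective v in zero , a , hit
    ; edges     = λ u w → mk⇔ (to u w ∘ Equivalence.to (H⇔ u w)) (Equivalence.from (H⇔ u w) ∘ from u w)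
    ; subgraph  = H⊆G
    }
    where
    Traced : V → V → Set
    Traced u w = ∃ λ (a : Fin 1) → ∃ λ i → ∃ λ j → T (cycleG N i j) × (orbit i ≡ u) × (orbit j ≡ w)
    to : ∀ u w → w ≡ f u ⊎ u ≡ f w → Traced u w
    to u w (inj₁ w≡fu) = let i , hit = orbit-surjective u in
      zero , i , rotate 1 i , Equivalence.from (cycleG-adjacent i (rotate 1 i)) (inj₁ refl) , hit ,
      trans (orbit-rotate-1 period i) (trans (cong f hit) (sym w≡fu))
    to u w (inj₂ u≡fw) = let j , hit = orbit-surjective w in
      zero , rotate 1 j , j , Equivalence.from (cycleG-adjacent (rotate 1 j) j) (inj₂ refl) ,
      trans (orbit-rotate-1 period j) (trans (cong f hit) (sym u≡fw)) , hit
    from : ∀ u w → Traced u w → w ≡ f u ⊎ u ≡ f w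
    from u w (zero , i , j , adjacent , refl , refl) with Equivalence.to (cycleG-adjacent i j) adjacent
    ... | inj₁ refl = inj₁ (orbit-rotate-1 period i)
    ... | inj₂ refl = inj₂ (orbit-rotate-1 period j)

involutive-swap : ∀ {A : Set} (f : A → A) → (∀ a → f (f a) ≡ a) → ∀ a b → f a ≡ b ⇔ a ≡ f b
involutive-swap f f-involutive a b =
  mk⇔ (λ fa≡b → trans (sym (f-involutive a)) (cong f fa≡b))
      (λ a≡fb → trans (cong f a≡fb) (f-involutive b))

module _ {s : ℕ} where

  suc+suc-opposite : ∀ (c : Fin s) → suc (toℕ c) + suc (toℕ (opposite c)) ≡ suc s
  suc+suc-opposite c = begin
    suc (toℕ c) + suc (toℕ (opposite c))   ≡⟨ +-suc (suc (toℕ c)) _ ⟩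
    suc (suc (toℕ c) + toℕ (opposite c))   ≡⟨ cong (λ o → suc (suc (toℕ c) + o)) (opposite-prop c) ⟩
    suc (suc (toℕ c) + (s ∸ suc (toℕ c)))  ≡⟨ cong suc (m+[n∸m]≡n (toℕ<n c)) ⟩
    suc s                                   ∎
    where open ≡-Reasoning

  alternate : ℕ → Fin s → Fin s
  alternate zero          = id
  alternate (suc zero)    = opposite
  alternate (suc (suc i)) = alternate i

  alternate-involutive : ∀ i c → alternate i (alternate i c) ≡ c
  alternate-involutive zero          c = refl
  alternate-involutive (suc zero)    c = opposite-involutive c
  alternate-involutive (suc (suc i)) c = alternate-involutive i c

  offset : ℕ → Fin s → ℕ
  offset zero          c = 0
  offset (suc zero)    c = suc (toℕ c)
  offset (suc (suc i)) c = offset i c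

  offset-odd : ∀ j c → offset (suc (j * 2)) c ≡ suc (toℕ c)
  offset-odd zero    c = refl
  offset-odd (suc j) c = offset-odd j c

  rotate-alternate : ∀ i c (x : Fin (suc s)) →
    rotate (suc (toℕ (alternate i c))) (rotate (offset i c) x) ≡ rotate (offset (suc i) c) x
  rotate-alternate zero          c x = rotate-+ 0 _ x
  rotate-alternate (suc zero)    c x = begin
    rotate (suc (toℕ (opposite c))) (rotate (suc (toℕ c)) x)  ≡⟨ rotate-+ _ _ x ⟩
    rotate (suc (toℕ c) + suc (toℕ (opposite c))) x           ≡⟨ cong (λ d → rotate d x) (suc+suc-opposite c) ⟩
    rotate (suc s) x                                          ≡⟨ cong (λ d → rotate d x) (+-identityʳ (suc s)) ⟨
    rotate (1 * suc s) x                                      ≡⟨ rotate-multiple 1 x ⟩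
    x                                                         ≡⟨ rotate-0 x ⟨
    rotate 0 x                                                ∎
    where open ≡-Reasoning
  rotate-alternate (suc (suc i)) c x = rotate-alternate i c x

closing : ∀ {s} → Fin (suc s) → Fin (suc s)
closing zero    = zero
closing (suc c) = suc (opposite c)

closing-involutive : ∀ {s} (c : Fin (suc s)) → closing (closing c) ≡ c
closing-involutive zero    = refl
closing-involutive (suc c) = cong suc (opposite-involutive c)

module Construction (h v : ℕ) where

  k t : ℕ
  k = 4 + h * 2
  t = 3 + v * 2

  Colour Vertex : Set
  Colour = Fin (2 + v * 2)
  Vertex = Fin k × Fin t

  G : Graph Vertex
  G = tensorG (cycleG k) (completeG t)

  lastLayer : Fin k
  lastLayer = fromℕ (3 + h * 2)

  layerPerm : Fin k → Colour → Colour
  layerPerm i with i ≟ᶠ lastLayer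
  ... | yes _ = closing
  ... | no  _ = alternate (toℕ i)

  layerPerm-involutive : ∀ i c → layerPerm i (layerPerm i c) ≡ c
  layerPerm-involutive i c with i ≟ᶠ lastLayer
  ... | yes _ = closing-involutive c
  ... | no  _ = alternate-involutive (toℕ i) c

  layerPerm-last : layerPerm lastLayer ≡ closing
  layerPerm-last with lastLayer ≟ᶠ lastLayer
  ... | yes _    = refl
  ... | no  last≢last = contradiction refl last≢last

  layerPerm-inner : ∀ i → i ≢ lastLayer → layerPerm i ≡ alternate (toℕ i)
  layerPerm-inner i i≢last with i ≟ᶠ lastLayer
  ... | yes i≡last = contradiction i≡last i≢last
  ... | no  _      = refl

  shift : Fin k → Colour → ℕ
  shift i c = suc (toℕ (layerPerm i c))

  step : Colour → Vertex → Vertex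
  step c (i , x) = rotate 1 i , rotate (shift i c) x

  roundShift : Colour → ℕ
  roundShift c = suc (toℕ c) + suc (toℕ (closing c))

  roundShift⁻¹ : Colour → ℕ
  roundShift⁻¹ zero    = 2 + v
  roundShift⁻¹ (suc _) = 1

  roundShift-unit : ∀ c → (roundShift c * roundShift⁻¹ c) % t ≡ 1 % t
  roundShift-unit zero    = trans (cong (_% t) (double v)) ([m+n]%n≡m%n 1 t)
    where
    double : ∀ v → 2 * (2 + v) ≡ 1 + (3 + v * 2)
    double = solve-∀
  roundShift-unit (suc c) = begin
    (roundShift (suc c) * 1) % t  ≡⟨ cong (_% t) (*-identityʳ (roundShift (suc c))) ⟩
    roundShift (suc c) % t        ≡⟨ cong (λ d → suc (suc d) % t) (+-suc (toℕ c) (suc (toℕ (opposite c)))) ⟩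
    (2 + (suc (toℕ c) + suc (toℕ (opposite c)))) % t ≡⟨ cong (λ d → (2 + d) % t) (suc+suc-opposite c) ⟩
    (1 + t) % t                   ≡⟨ [m+n]%n≡m%n 1 t ⟩
    1 % t                         ∎
    where open ≡-Reasoning

  module _ (c : Colour) where

    walk : ∀ i (i<k : i < k) x → fold (zero , x) (step c) i ≡ (fromℕ< i<k , rotate (offset i c) x)
    walk zero    _     x = cong (zero ,_) (sym (rotate-0 x))
    walk (suc i) 1+i<k x = begin
      step c (fold (zero , x) (step c) i)                          ≡⟨ cong (step c) (walk i i<k x) ⟩
      step c (fromℕ< i<k , rotate (offset i c) x)                  ≡⟨ ×-≡,≡→≡ (rotate-1-fromℕ< i<k 1+i<k , value) ⟩
      (fromℕ< 1+i<k , rotate (offset (suc i) c) x)                 ∎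
      where
      open ≡-Reasoning
      i<k = <-trans (n<1+n i) 1+i<k
      inner : fromℕ< i<k ≢ lastLayer
      inner i≡last = <⇒≢ (≤-pred 1+i<k) (begin
        i                   ≡⟨ toℕ-fromℕ< i<k ⟨
        toℕ (fromℕ< i<k)   ≡⟨ cong toℕ i≡last ⟩
        toℕ lastLayer       ≡⟨ toℕ-fromℕ (3 + h * 2) ⟩
        3 + h * 2           ∎)
      value : rotate (shift (fromℕ< i<k) c) (rotate (offset i c) x) ≡ rotate (offset (suc i) c) x
      value = begin
        rotate (shift (fromℕ< i<k) c) (rotate (offset i c) x)
          ≡⟨ cong (λ σ → rotate (suc (toℕ (σ c))) (rotate (offset i c) x)) inner-perm ⟩
        rotate (suc (toℕ (alternate i c))) (rotate (offset i c) x)  ≡⟨ rotate-alternate i c x ⟩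
        rotate (offset (suc i) c) x                                 ∎
        where
        inner-perm : layerPerm (fromℕ< i<k) ≡ alternate i
        inner-perm = trans (layerPerm-inner _ inner) (cong alternate (toℕ-fromℕ< i<k))

    round : ∀ x → fold (zero , x) (step c) k ≡ (zero , rotate (roundShift c) x)
    round x = begin
      step c (fold (zero , x) (step c) (3 + h * 2))            ≡⟨ cong (step c) (walk (3 + h * 2) ≤-refl x) ⟩
      step c (fromℕ< ≤-refl , rotate (offset (3 + h * 2) c) x)
        ≡⟨ cong (λ i → step c (i , rotate (offset (3 + h * 2) c) x)) (fromℕ-def (3 + h * 2)) ⟨
      step c (lastLayer , rotate (offset (3 + h * 2) c) x)
        ≡⟨ cong (λ o → step c (lastLayer , rotate o x)) (offset-odd (suc h) c) ⟩
      (rotate 1 lastLayer , rotate (shift lastLayer c) (rotate (suc (toℕ c)) x))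
                                                                ≡⟨ ×-≡,≡→≡ (rotate-1-fromℕ (3 + h * 2) , value) ⟩
      (zero , rotate (roundShift c) x)                          ∎
      where
      open ≡-Reasoning
      value : rotate (shift lastLayer c) (rotate (suc (toℕ c)) x) ≡ rotate (roundShift c) x
      value = trans (cong (λ σ → rotate (suc (toℕ (σ c))) (rotate (suc (toℕ c)) x)) layerPerm-last) (rotate-+ _ _ x)

    rounds : ∀ q x → fold (zero , x) (step c) (q * k) ≡ (zero , rotate (q * roundShift c) x)
    rounds zero    x = cong (zero ,_) (sym (rotate-0 x))
    rounds (suc q) x = begin
      fold (zero , x) (step c) (k + q * k)                         ≡⟨ fold-+ (zero , x) (step c) k ⟩
      fold (fold (zero , x) (step c) (q * k)) (step c) k           ≡⟨ cong (λ u → fold u (step c) k) (rounds q x) ⟩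
      fold (zero , rotate (q * roundShift c) x) (step c) k         ≡⟨ round _ ⟩
      (zero , rotate (roundShift c) (rotate (q * roundShift c) x)) ≡⟨ cong (zero ,_) (rotate-+ _ _ x) ⟩
      (zero , rotate (q * roundShift c + roundShift c) x)          ≡⟨ cong (λ d → zero , rotate d x) (+-comm (q * roundShift c) _) ⟩
      (zero , rotate (suc q * roundShift c) x)                     ∎
      where open ≡-Reasoning

    orbit-closed-form : ∀ i (i<k : i < k) q →
      fold (zero , zero) (step c) (i + q * k) ≡ (fromℕ< i<k , rotate (q * roundShift c + offset i c) zero)
    orbit-closed-form i i<k q = begin
      fold (zero , zero) (step c) (i + q * k)                     ≡⟨ fold-+ (zero , zero) (step c) i ⟩
      fold (fold (zero , zero) (step c) (q * k)) (step c) i       ≡⟨ cong (λ u → fold u (step c) i) (rounds q zero) ⟩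
      fold (zero , rotate (q * roundShift c) zero) (step c) i     ≡⟨ walk i i<k _ ⟩
      (fromℕ< i<k , rotate (offset i c) (rotate (q * roundShift c) zero))
                                                                  ≡⟨ cong (fromℕ< i<k ,_) (rotate-+ (q * roundShift c) (offset i c) zero) ⟩
      (fromℕ< i<k , rotate (q * roundShift c + offset i c) zero)  ∎
      where open ≡-Reasoning

    orbit-period : fold (zero , zero) (step c) (k * t) ≡ (zero , zero)
    orbit-period = begin
      fold (zero , zero) (step c) (k * t)               ≡⟨ cong (fold (zero , zero) (step c)) (*-comm k t) ⟩
      fold (zero , zero) (step c) (t * k)               ≡⟨ rounds t zero ⟩
      (zero , rotate (t * roundShift c) zero)           ≡⟨ cong (λ d → zero , rotate d zero) (*-comm t (roundShift c)) ⟩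
      (zero , rotate (roundShift c * t) zero)           ≡⟨ cong (zero ,_) (rotate-multiple (roundShift c) zero) ⟩
      (zero , zero)                                     ∎
      where open ≡-Reasoning

    round-values-injective : ∀ {q q′} o → q < t → q′ < t →
      rotate (q * roundShift c + o) zero ≡ rotate (q′ * roundShift c + o) zero → q ≡ q′
    round-values-injective {q} {q′} o q<t q′<t eq = begin
      q       ≡⟨ m<n⇒m%n≡m q<t ⟨
      q % t   ≡⟨ %-*-cancelʳ {roundShift c} {roundShift⁻¹ c} t (roundShift-unit c) {q} {q′}
                   (%-+-cancelʳ o {q * roundShift c} {q′ * roundShift c} t values) ⟩
      q′ % t  ≡⟨ m<n⇒m%n≡m q′<t ⟩
      q′      ∎
      where
      open ≡-Reasoning
      values : (q * roundShift c + o) % t ≡ (q′ * roundShift c + o) % t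
      values = trans (sym (toℕ-rotate (q * roundShift c + o) zero))
                     (trans (cong toℕ eq) (toℕ-rotate (q′ * roundShift c + o) zero))

    orbit-position : ∀ (a : Fin (k * t)) → orbit (step c) (zero , zero) a ≡
      (fromℕ< (m%n<n (toℕ a) k) , rotate (toℕ a / k * roundShift c + offset (toℕ a % k) c) zero)
    orbit-position a = trans (cong (fold (zero , zero) (step c)) (m≡m%n+[m/n]*n (toℕ a) k))
                             (orbit-closed-form _ (m%n<n (toℕ a) k) (toℕ a / k))

    orbit-injective : ∀ {a b : Fin (k * t)} →
      orbit (step c) (zero , zero) a ≡ orbit (step c) (zero , zero) b → a ≡ b
    orbit-injective {a} {b} eq = toℕ-injective (begin
      toℕ a                      ≡⟨ m≡m%n+[m/n]*n (toℕ a) k ⟩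
      toℕ a % k + toℕ a / k * k  ≡⟨ cong₂ (λ i q → i + q * k) same-layer same-round ⟩
      toℕ b % k + toℕ b / k * k  ≡⟨ m≡m%n+[m/n]*n (toℕ b) k ⟨
      toℕ b                      ∎)
      where
      open ≡-Reasoning
      positions≡ = trans (sym (orbit-position a)) (trans eq (orbit-position b))
      same-layer : toℕ a % k ≡ toℕ b % k
      same-layer = trans (sym (toℕ-fromℕ< _)) (trans (cong (toℕ ∘ proj₁) positions≡) (toℕ-fromℕ< _))
      round< : ∀ (a : Fin (k * t)) → toℕ a / k < t
      round< a = m<n*o⇒m/o<n (subst (toℕ a <_) (*-comm k t) (toℕ<n a))
      same-round : toℕ a / k ≡ toℕ b / k
      same-round = round-values-injective (offset (toℕ a % k) c) (round< a) (round< b)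
        (trans (cong proj₂ positions≡) (cong (λ i → rotate (toℕ b / k * roundShift c + offset i c) zero) (sym same-layer)))

  edgeColour : Fin k → Fin t → Fin t → Colour
  edgeColour i x y = layerPerm i (gap x y)

  edgeColour-spec : ∀ i x y c → (x ≢ y × edgeColour i x y ≡ c) ⇔ y ≡ rotate (shift i c) x
  edgeColour-spec i x y c = ⇔-trans (mk⇔ id id ×-⇔ involutive-swap (layerPerm i) (layerPerm-involutive i) (gap x y) c)
                                    (gap-spec x y (layerPerm i c))

  colour : Vertex → Vertex → Colour
  colour (i , x) (j , y) with j ≟ᶠ rotate 1 i
  ... | yes _ = edgeColour i x y
  ... | no  _ = edgeColour j y x

  layers-asymmetric : ∀ {i j : Fin k} → j ≡ rotate 1 i → i ≢ rotate 1 j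
  layers-asymmetric = rotate-1-asymmetric (s≤s (s≤s (s≤s z≤n)))

  colour-forward : ∀ i x j y → j ≡ rotate 1 i → colour (i , x) (j , y) ≡ edgeColour i x y
  colour-forward i x j y j≡ with j ≟ᶠ rotate 1 i
  ... | yes _  = refl
  ... | no j≢ = contradiction j≡ j≢

  colour-backward : ∀ i x j y → i ≡ rotate 1 j → colour (i , x) (j , y) ≡ edgeColour j y x
  colour-backward i x j y i≡ with j ≟ᶠ rotate 1 i
  ... | yes j≡ = contradiction i≡ (layers-asymmetric j≡)
  ... | no  _  = refl

  G-adjacent : ∀ i x j y → T (G (i , x) (j , y)) ⇔ ((j ≡ rotate 1 i ⊎ i ≡ rotate 1 j) × x ≢ y)
  G-adjacent i x j y = ⇔-trans T-∧ (cycleG-adjacent i j ×-⇔ completeG-adjacent x y)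

  G-symmetric : ∀ u w → T (G u w) → T (G w u)
  G-symmetric (i , x) (j , y) adj =
    let adjacent , x≢y = Equivalence.to (G-adjacent i x j y) adj in
    Equivalence.from (G-adjacent j y i x) (swap adjacent , x≢y ∘ sym)

  colour-symmetric : ∀ u w → T (G u w) → colour u w ≡ colour w u
  colour-symmetric (i , x) (j , y) adj with proj₁ (Equivalence.to (G-adjacent i x j y) adj)
  ... | inj₁ j≡ = trans (colour-forward i x j y j≡) (sym (colour-backward j y i x j≡))
  ... | inj₂ i≡ = trans (colour-backward i x j y i≡) (sym (colour-forward j y i x i≡))

  ColourClass : Colour → Vertex → Vertex → Set
  ColourClass c u w = T (G u w) × colour u w ≡ c

  colourClass-forward : ∀ c i x j y → j ≡ rotate 1 i → ColourClass c (i , x) (j , y) ⇔ (j , y) ≡ step c (i , x)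
  colourClass-forward c i x j y j≡ = mk⇔ to from
    where
    to : ColourClass c (i , x) (j , y) → (j , y) ≡ step c (i , x)
    to (adj , col) = ×-≡,≡→≡ (j≡ , Equivalence.to (edgeColour-spec i x y c)
                                     (proj₂ (Equivalence.to (G-adjacent i x j y) adj) , trans (sym (colour-forward i x j y j≡)) col))
    from : (j , y) ≡ step c (i , x) → ColourClass c (i , x) (j , y)
    from w≡ = let x≢y , col = Equivalence.from (edgeColour-spec i x y c) (cong proj₂ w≡) in
      Equivalence.from (G-adjacent i x j y) (inj₁ j≡ , x≢y) , trans (colour-forward i x j y j≡) col

  colourClass⇔ : ∀ c u w → ColourClass c u w ⇔ (w ≡ step c u ⊎ u ≡ step c w)
  colourClass⇔ c (i , x) (j , y) = mk⇔ to from
    where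
    to : ColourClass c (i , x) (j , y) → (j , y) ≡ step c (i , x) ⊎ (i , x) ≡ step c (j , y)
    to (adj , col) with proj₁ (Equivalence.to (G-adjacent i x j y) adj)
    ... | inj₁ j≡ = inj₁ (Equivalence.to (colourClass-forward c i x j y j≡) (adj , col))
    ... | inj₂ i≡ = inj₂ (Equivalence.to (colourClass-forward c j y i x i≡)
                            (G-symmetric (i , x) (j , y) adj , trans (sym (colour-symmetric (i , x) (j , y) adj)) col))
    from : (j , y) ≡ step c (i , x) ⊎ (i , x) ≡ step c (j , y) → ColourClass c (i , x) (j , y)
    from (inj₁ w≡) = Equivalence.from (colourClass-forward c i x j y (cong proj₁ w≡)) w≡
    from (inj₂ u≡) = let adj , col = Equivalence.from (colourClass-forward c j y i x (cong proj₁ u≡)) u≡ in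
      G-symmetric (j , y) (i , x) adj , trans (sym (colour-symmetric (j , y) (i , x) adj)) col

  factorization : CycleFactorization (k * t) G
  factorization = record
    { s         = 2 + v * 2
    ; colour    = colour
    ; symmetric = colour-symmetric
    ; factor    = λ c → orbit⇒IsCycleFactor (step c) (zero , zero) G (ColourClass c)
                          (orbit-period c) (orbit-injective c)
                          (injective⇒surjective *↔× (orbit (step c) (zero , zero)) (orbit-injective c))
                          (colourClass⇔ c) (λ _ _ → proj₁)
    }

even≥4 : ∀ {k} → 2 ∣ k → 4 ≤ k → ∃ λ h → k ≡ 4 + h * 2
even≥4 (divides 0 refl) ()
even≥4 (divides 1 refl) (s≤s (s≤s ()))
even≥4 (divides (suc (suc h)) refl) _ = h , refl

odd⇒1+double : ∀ n → ¬ 2 ∣ n → ∃ λ u → n ≡ suc (u * 2)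
odd⇒1+double zero          ¬2∣n = contradiction (divides 0 refl) ¬2∣n
odd⇒1+double (suc zero)    _    = 0 , refl
odd⇒1+double (suc (suc n)) ¬2∣n =
  let u , n≡ = odd⇒1+double n (¬2∣n ∘ λ { (divides q n≡) → divides (suc q) (cong (2 +_) n≡) }) in
  suc u , cong (2 +_) n≡

odd≥3 : ∀ {t} → ¬ 2 ∣ t → 3 ≤ t → ∃ λ v → t ≡ 3 + v * 2
odd≥3 {t} ¬2∣t 3≤t with odd⇒1+double t ¬2∣t
... | zero  , refl = contradiction 3≤t λ { (s≤s ()) }
... | suc v , refl = v , refl

lemma3p2 : ∀ (k t : ℕ) → 2 ∣ k → 4 ≤ k → ¬ (2 ∣ t) → 3 ≤ t →
    CycleFactorization (k * t) (tensorG (cycleG k) (completeG t))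
lemma3p2 k t 2∣k 4≤k ¬2∣t 3≤t with even≥4 2∣k 4≤k | odd≥3 ¬2∣t 3≤t
... | h , refl | v , refl = Construction.factorization h v
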